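{- Let $W$ be a double occurrence word whose interlacement graph $G=\mathcal{I}(W)$ is connected, and let $v,w$ be two vertices of $G$. Then an occurrence of $v$ and an occurrence of $w$ are consecutive in $W$ (regarded cyclically) if and only if there is an orientation of $W$ for which the corresponding Naji solution $\beta$ satisfies $\beta(x,v)=\beta(x,w)$ for all $x\notin\{v,w\}$.
   Context: A double occurrence word is a word in which each letter appears exactly twice; its interlacement graph $\mathcal{I}(W)$ has the letters as vertices, with $v,w$ adjacent iff they appear in the order $v\,w\,v\,w$ or $w\,v\,w\,v$. Words are considered cyclically (the last and first letters are consecutive). An orientation of $W$ designates one occurrence of each letter $v$ as initial, written $v^{in}$, and the other as terminal, $v^{out}$. The Naji solution corresponding to an orientation is the function $\beta$ on ordered pairs of distinct letters defined by: $\beta(v,w)=0$ if and only if, when $W$ is cyclically permuted to begin with $v^{in}$, $w^{out}$ precedes $v^{out}$; and $\beta(v,w)=1$ otherwise. -}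

module Defs where

open import Data.Nat using (ℕ; zero; suc; _+_; _∸_; _<_; _≤ᵇ_)
open import Data.Fin using (Fin; toℕ)
open import Data.Fin.Properties using (_≟_)
open import Data.List using (List; length; filter)
open import Data.List.Base using ()
open import Data.Fin.Base using ()
open import Data.Product using (Σ; ∃; _×_; _,_)
open import Data.Sum using (_⊎_)
open import Data.Bool using (Bool; true; false; if_then_else_)
open import Relation.Binary.PropositionalEquality using (_≡_; _≢_)
open import Relation.Binary.Construct.Closure.ReflexiveTransitive using (Star)
import Data.List as L
open import Data.Nat using (_<ᵇ_)

-- A word of length n + n over the alphabet Fin n (letters = vertices).
Word : ℕ → Set
Word n = Fin (n + n) → Fin n

positions : (n : ℕ) → List (Fin (n + n))
positions n = L.allFin (n + n)

occ : {n : ℕ} → Word n → Fin n → ℕ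
occ {n} W v = length (filter (λ i → W i ≟ v) (positions n))

IsDOW : {n : ℕ} → Word n → Set
IsDOW W = ∀ v → occ W v ≡ 2

Interlaced : {n : ℕ} → Word n → Fin n → Fin n → Set
Interlaced {n} W v w =
  v ≢ w ×
  Σ (Fin (n + n)) λ p₁ → Σ (Fin (n + n)) λ p₂ →
  Σ (Fin (n + n)) λ q₁ → Σ (Fin (n + n)) λ q₂ →
    W p₁ ≡ v × W p₂ ≡ v × W q₁ ≡ w × W q₂ ≡ w ×
    ((toℕ p₁ < toℕ q₁ × toℕ q₁ < toℕ p₂ × toℕ p₂ < toℕ q₂) ⊎
     (toℕ q₁ < toℕ p₁ × toℕ p₁ < toℕ q₂ × toℕ q₂ < toℕ p₂))

ConnectedInterlacement : {n : ℕ} → Word n → Set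
ConnectedInterlacement W = ∀ u u′ → Star (Interlaced W) u u′

CycNext : {n : ℕ} → Fin (n + n) → Fin (n + n) → Set
CycNext {n} i j = suc (toℕ i) ≡ toℕ j ⊎ (suc (toℕ i) ≡ n + n × toℕ j ≡ 0)

Consecutive : {n : ℕ} → Word n → Fin n → Fin n → Set
Consecutive {n} W v w =
  Σ (Fin (n + n)) λ i → Σ (Fin (n + n)) λ j →
    CycNext {n} i j × ((W i ≡ v × W j ≡ w) ⊎ (W i ≡ w × W j ≡ v))

record Orientation {n : ℕ} (W : Word n) : Set where
  field
    ini    : Fin n → Fin (n + n)
    out    : Fin n → Fin (n + n)
    ini-ok : ∀ v → W (ini v) ≡ v
    out-ok : ∀ v → W (out v) ≡ v
    ini≢out : ∀ v → ini v ≢ out v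

-- offset of position q after cyclically permuting the word to start at p
offset : {n : ℕ} → Fin (n + n) → Fin (n + n) → ℕ
offset {n} p q =
  if toℕ p ≤ᵇ toℕ q then toℕ q ∸ toℕ p else (toℕ q + (n + n)) ∸ toℕ p

naji : {n : ℕ} {W : Word n} → Orientation W → Fin n → Fin n → ℕ
naji {n} O v w =
  if offset {n} (ini v) (out w) <ᵇ offset {n} (ini v) (out v) then 0 else 1
  where open Orientation O

module Submission where

-- If occurrences of v and w at cyclic positions i, j = i + 1 are made the terminal ones, then
-- for every other letter x the cyclic offsets of i and j measured from x^in are consecutive
-- integers, neither equal to the offset of x^out, so β(x,v) = β(x,w).
-- Conversely let p < q be the terminal occurrences of v and w. For x ≠ v, w, β(x,v) = β(x,w)
-- says that, read from x^in, x^out is not cut off from x^in by p and q; hence x has both or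
-- none of its occurrences strictly between p and q. Adding p (resp. q) when v^in (resp. w^in)
-- lies strictly between them gives an interval containing both or none of the occurrences of
-- every letter. Such an interval is closed under interlacement, so in a connected interlacement
-- graph it is empty or everything, which forces p and q to be cyclically adjacent.

open import Defs
open import Data.Nat using (ℕ; suc; _+_; _<_; _≤_; _≤ᵇ_; _<ᵇ_; z≤n; s≤s⁻¹)
open import Data.Nat using () renaming (_≟_ to _≟ℕ_)
open import Data.Nat.Properties hiding (_≟_)
open import Data.Fin using (Fin; toℕ; fromℕ<)
open import Data.Fin.Properties using (_≟_; toℕ-injective; toℕ<n; toℕ-fromℕ<)
open import Data.Bool using (Bool; true; false; if_then_else_)
open import Data.Bool.Properties using (T-≡)
open import Data.Empty using (⊥-elim)
open import Data.Product using (Σ; ∃; _×_; _,_; proj₁; proj₂)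
open import Data.Sum using (_⊎_; inj₁; inj₂)
open import Function.Bundles using (_⇔_; mk⇔; Equivalence)
open import Relation.Nullary using (¬_; yes; no; Dec)
open import Relation.Nullary.Reflects using (ofʸ)
open import Relation.Binary.PropositionalEquality
open import Relation.Binary.Definitions using (tri<; tri≈; tri>)
open import Relation.Binary.Construct.Closure.ReflexiveTransitive as Star using (Star)
open import Function using (_∘′_; id)
open import Data.List using (List; []; _∷_; length; filter; allFin)
open import Data.List.Membership.Propositional using (_∈_)
open import Data.List.Membership.Propositional.Properties using (∈-filter⁺; ∈-filter⁻; ∈-allFin)
open import Data.List.Relation.Unary.Any using (here; there)
import Data.List.Relation.Unary.All as All
import Data.List.Relation.Unary.AllPairs as AllPairs
open import Data.List.Relation.Unary.Unique.Propositional using (Unique)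
import Data.List.Relation.Unary.Unique.Propositional.Properties as Unique
open import Data.List.Relation.Unary.Unique.Propositional.Properties using (allFin⁺)

≤⇒≤ᵇ≡true : ∀ {m n} → m ≤ n → (m ≤ᵇ n) ≡ true
≤⇒≤ᵇ≡true m≤n = Equivalence.to T-≡ (≤⇒≤ᵇ m≤n)

>⇒≤ᵇ≡false : ∀ {m n} → n < m → (m ≤ᵇ n) ≡ false
>⇒≤ᵇ≡false {m} {n} n<m with m ≤ᵇ n | ≤ᵇ-reflects-≤ m n
... | false | _      = refl
... | true  | ofʸ m≤n = ⊥-elim (<⇒≱ n<m m≤n)

<⇒<ᵇ≡true : ∀ {m n} → m < n → (m <ᵇ n) ≡ true
<⇒<ᵇ≡true m<n = Equivalence.to T-≡ (<⇒<ᵇ m<n)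

≥⇒<ᵇ≡false : ∀ {m n} → n ≤ m → (m <ᵇ n) ≡ false
≥⇒<ᵇ≡false {m} {n} n≤m with m <ᵇ n | <ᵇ-reflects-< m n
... | false | _      = refl
... | true  | ofʸ m<n = ⊥-elim (<⇒≱ m<n n≤m)

<ᵇ-suc : ∀ {a c} → c ≢ a → c ≢ suc a → (a <ᵇ c) ≡ (suc a <ᵇ c)
<ᵇ-suc {a} {c} c≢a c≢1+a with <-cmp a c
... | tri< a<c _ _ = trans (<⇒<ᵇ≡true a<c) (sym (<⇒<ᵇ≡true (≤∧≢⇒< a<c λ e → c≢1+a (sym e))))
... | tri≈ _ a≡c _ = ⊥-elim (c≢a (sym a≡c))
... | tri> _ _ c<a = trans (≥⇒<ᵇ≡false (<⇒≤ c<a)) (sym (≥⇒<ᵇ≡false (m≤n⇒m≤1+n (<⇒≤ c<a))))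

<ᵇ-between : ∀ {a b c} → a < b → b < c → (a <ᵇ b) ≢ (c <ᵇ b)
<ᵇ-between a<b b<c eq with trans (sym (<⇒<ᵇ≡true a<b)) (trans eq (≥⇒<ᵇ≡false (<⇒≤ b<c)))
... | ()

if01-injective : ∀ {b₁ b₂ : Bool} → (if b₁ then 0 else 1) ≡ (if b₂ then 0 else 1) → b₁ ≡ b₂
if01-injective {true}  {true}  _ = refl
if01-injective {false} {false} _ = refl

Between : ∀ {m} → Fin m → Fin m → Fin m → Set
Between p q r = toℕ p < toℕ r × toℕ r < toℕ q

between-nonempty : ∀ {m} {p q : Fin m} → suc (toℕ p) < toℕ q → ∃ (Between p q)
between-nonempty {m} {p} {q} 1+p<q = fromℕ< k<m ,
  subst (λ k → toℕ p < k × k < toℕ q) (sym (toℕ-fromℕ< k<m)) (n<1+n _ , 1+p<q)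
  where
  k<m : suc (toℕ p) < m
  k<m = <-trans 1+p<q (toℕ<n q)

outside-or-everything : ∀ {m} (p q : Fin m) →
  (∃ λ e → toℕ e < toℕ p ⊎ toℕ q < toℕ e) ⊎ (toℕ p ≡ 0 × suc (toℕ q) ≡ m)
outside-or-everything {m} p q with toℕ p ≟ℕ 0 | suc (toℕ q) ≟ℕ m
... | yes p≡0 | yes 1+q≡m = inj₂ (p≡0 , 1+q≡m)
... | no  p≢0 | _         = inj₁ (fromℕ< 0<m , inj₁ 0<p)
  where
  0<m : 0 < m
  0<m = ≤-<-trans z≤n (toℕ<n p)
  0<p : toℕ (fromℕ< 0<m) < toℕ p
  0<p = subst (_< toℕ p) (sym (toℕ-fromℕ< 0<m)) (≤∧≢⇒< z≤n (λ 0≡p → p≢0 (sym 0≡p)))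
... | yes _   | no 1+q≢m  = inj₁ (fromℕ< 1+q<m , inj₂ q<1+q)
  where
  1+q<m : suc (toℕ q) < m
  1+q<m = ≤∧≢⇒< (toℕ<n q) 1+q≢m
  q<1+q : toℕ q < toℕ (fromℕ< 1+q<m)
  q<1+q = subst (toℕ q <_) (sym (toℕ-fromℕ< 1+q<m)) (n<1+n _)

module _ {n : ℕ} where
  private
    N : ℕ
    N = n + n

    off : Fin N → Fin N → ℕ
    off = offset {n}

  offset-≤ : ∀ (s : Fin N) {r} → toℕ s ≤ toℕ r → off s r + toℕ s ≡ toℕ r
  offset-≤ s {r} s≤r rewrite ≤⇒≤ᵇ≡true s≤r = m∸n+n≡m s≤r

  offset-> : ∀ (s : Fin N) {r} → toℕ r < toℕ s → off s r + toℕ s ≡ toℕ r + N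
  offset-> s {r} r<s rewrite >⇒≤ᵇ≡false r<s =
    m∸n+n≡m (≤-trans (<⇒≤ (toℕ<n s)) (m≤n+m N (toℕ r)))

  private
    offset-cancel : ∀ s x y {X Y} →
      off s x + toℕ s ≡ X → off s y + toℕ s ≡ Y → X < Y → off s x < off s y
    offset-cancel s x y ex ey X<Y = +-cancelʳ-< (toℕ s) _ _ (subst₂ _<_ (sym ex) (sym ey) X<Y)

  offset-<-after : ∀ s {x y : Fin N} → toℕ s ≤ toℕ x → toℕ x < toℕ y → off s x < off s y
  offset-<-after s {x} {y} s≤x x<y =
    offset-cancel s x y (offset-≤ s s≤x) (offset-≤ s (<⇒≤ (≤-<-trans s≤x x<y))) x<y

  offset-<-before : ∀ s {x y : Fin N} → toℕ x < toℕ y → toℕ y < toℕ s → off s x < off s y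
  offset-<-before s {x} {y} x<y y<s =
    offset-cancel s x y (offset-> s (<-trans x<y y<s)) (offset-> s y<s) (+-monoˡ-< N x<y)

  offset-<-wrap : ∀ s {x y : Fin N} → toℕ y < toℕ s → toℕ s ≤ toℕ x → off s x < off s y
  offset-<-wrap s {x} {y} y<s s≤x =
    offset-cancel s x y (offset-≤ s s≤x) (offset-> s y<s) (<-≤-trans (toℕ<n _) (m≤n+m N (toℕ y)))

  offset-≢ : ∀ s {x y : Fin N} → toℕ x < toℕ y → off s x ≢ off s y
  offset-≢ s {x} {y} x<y with toℕ s ≤? toℕ x | toℕ y <? toℕ s
  ... | yes s≤x | _       = <⇒≢ (offset-<-after s s≤x x<y)
  ... | no  s≰x | yes y<s = <⇒≢ (offset-<-before s x<y y<s)
  ... | no  s≰x | no  y≮s = ≢-sym (<⇒≢ (offset-<-wrap s (≰⇒> s≰x) (≮⇒≥ y≮s)))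

  offset-injective : ∀ s {r r′ : Fin N} → off s r ≡ off s r′ → r ≡ r′
  offset-injective s {r} {r′} eq with <-cmp (toℕ r) (toℕ r′)
  ... | tri< r<r′ _ _ = ⊥-elim (offset-≢ s r<r′ eq)
  ... | tri≈ _ r≡r′ _ = toℕ-injective r≡r′
  ... | tri> _ _ r′<r = ⊥-elim (offset-≢ s r′<r (sym eq))

  offset-suc : ∀ s {i j : Fin N} → CycNext {n} i j → s ≢ j → off s j ≡ suc (off s i)
  offset-suc s {i} {j} (inj₁ 1+i≡j) s≢j with toℕ s ≤? toℕ i
  ... | yes s≤i = +-cancelʳ-≡ (toℕ s) _ _ (begin
    off s j + toℕ s        ≡⟨ offset-≤ s (subst (toℕ s ≤_) 1+i≡j (m≤n⇒m≤1+n s≤i)) ⟩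
    toℕ j                  ≡⟨ sym 1+i≡j ⟩
    suc (toℕ i)            ≡⟨ cong suc (sym (offset-≤ s s≤i)) ⟩
    suc (off s i + toℕ s)  ∎)
    where open ≡-Reasoning
  ... | no s≰i = +-cancelʳ-≡ (toℕ s) _ _ (begin
    off s j + toℕ s        ≡⟨ offset-> s j<s ⟩
    toℕ j + N              ≡⟨ cong (_+ N) (sym 1+i≡j) ⟩
    suc (toℕ i + N)        ≡⟨ cong suc (sym (offset-> s (≰⇒> s≰i))) ⟩
    suc (off s i + toℕ s)  ∎)
    where
    open ≡-Reasoning
    j<s : toℕ j < toℕ s
    j<s = ≤∧≢⇒< (subst (_≤ toℕ s) 1+i≡j (≰⇒> s≰i)) (λ e → s≢j (sym (toℕ-injective e)))
  offset-suc s {i} {j} (inj₂ (1+i≡N , j≡0)) s≢j = +-cancelʳ-≡ (toℕ s) _ _ (begin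
    off s j + toℕ s        ≡⟨ offset-> s j<s ⟩
    toℕ j + N              ≡⟨ cong (_+ N) j≡0 ⟩
    N                      ≡⟨ sym 1+i≡N ⟩
    suc (toℕ i)            ≡⟨ cong suc (sym (offset-≤ s s≤i)) ⟩
    suc (off s i + toℕ s)  ∎)
    where
    open ≡-Reasoning
    j<s : toℕ j < toℕ s
    j<s = subst (_< toℕ s) (sym j≡0)
            (≤∧≢⇒< z≤n (λ 0≡s → s≢j (toℕ-injective (trans (sym 0≡s) (sym j≡0)))))
    s≤i : toℕ s ≤ toℕ i
    s≤i = s≤s⁻¹ (subst (toℕ s <_) (sym 1+i≡N) (toℕ<n s))

  offset-<ᵇ-consecutive : ∀ s {i j t : Fin N} → CycNext {n} i j → s ≢ j → t ≢ i → t ≢ j →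
    (off s i <ᵇ off s t) ≡ (off s j <ᵇ off s t)
  offset-<ᵇ-consecutive s {i} {j} {t} i→j s≢j t≢i t≢j = begin
    off s i <ᵇ off s t        ≡⟨ <ᵇ-suc (λ e → t≢i (offset-injective s e))
                                        (λ e → t≢j (offset-injective s (trans e (sym j-after-i)))) ⟩
    suc (off s i) <ᵇ off s t  ≡⟨ cong (_<ᵇ off s t) (sym j-after-i) ⟩
    off s j <ᵇ off s t        ∎
    where
    open ≡-Reasoning
    j-after-i : off s j ≡ suc (off s i)
    j-after-i = offset-suc s i→j s≢j

  -- Read cyclically from s, the hypothesis says that t does not lie between p and q.
  between-same-side : ∀ {p q s t : Fin N} → t ≢ p → t ≢ q →
    (off s p <ᵇ off s t) ≡ (off s q <ᵇ off s t) → Between p q s → Between p q t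
  between-same-side {p} {q} {s} {t} t≢p t≢q agree (p<s , s<q) with <-cmp (toℕ t) (toℕ p)
  ... | tri< t<p _ _ = ⊥-elim (<ᵇ-between (offset-<-wrap s t<s (<⇒≤ s<q))
                                          (offset-<-before s t<p p<s) (sym agree))
    where t<s = <-trans t<p p<s
  ... | tri≈ _ t≡p _ = ⊥-elim (t≢p (toℕ-injective t≡p))
  ... | tri> _ _ p<t with <-cmp (toℕ t) (toℕ q)
  ...   | tri< t<q _ _ = p<t , t<q
  ...   | tri≈ _ t≡q _ = ⊥-elim (t≢q (toℕ-injective t≡q))
  ...   | tri> _ _ q<t = ⊥-elim (<ᵇ-between (offset-<-after s (<⇒≤ s<q) q<t)
                                            (offset-<-wrap s p<s (<⇒≤ (<-trans s<q q<t))) (sym agree))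

  between-same-side⁻¹ : ∀ {p q s t : Fin N} → s ≢ p → s ≢ q →
    (off s p <ᵇ off s t) ≡ (off s q <ᵇ off s t) → Between p q t → Between p q s
  between-same-side⁻¹ {p} {q} {s} {t} s≢p s≢q agree (p<t , t<q) with <-cmp (toℕ s) (toℕ p)
  ... | tri< s<p _ _ = ⊥-elim (<ᵇ-between (offset-<-after s (<⇒≤ s<p) p<t)
                                          (offset-<-after s (<⇒≤ (<-trans s<p p<t)) t<q) agree)
  ... | tri≈ _ s≡p _ = ⊥-elim (s≢p (toℕ-injective s≡p))
  ... | tri> _ _ p<s with <-cmp (toℕ s) (toℕ q)
  ...   | tri< s<q _ _ = p<s , s<q
  ...   | tri≈ _ s≡q _ = ⊥-elim (s≢q (toℕ-injective s≡q))
  ...   | tri> _ _ q<s = ⊥-elim (<ᵇ-between (offset-<-before s p<t (<-trans t<q q<s))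
                                            (offset-<-before s t<q q<s) agree)

  adjacent-or-gap : ∀ {p q : Fin N} → toℕ p < toℕ q →
    CycNext {n} p q ⊎ CycNext {n} q p ⊎
    (∃ (Between p q) × ∃ λ e → toℕ e < toℕ p ⊎ toℕ q < toℕ e)
  adjacent-or-gap {p} {q} p<q with toℕ q ≟ℕ suc (toℕ p) | outside-or-everything p q
  ... | yes q≡1+p | _                     = inj₁ (inj₁ (sym q≡1+p))
  ... | no  _     | inj₂ (p≡0 , 1+q≡N)    = inj₂ (inj₁ (inj₂ (1+q≡N , p≡0)))
  ... | no  q≢1+p | inj₁ outside          =
    inj₂ (inj₂ (between-nonempty (≤∧≢⇒< p<q (λ e → q≢1+p (sym e))) , outside))

Convex : ∀ {m} → (Fin m → Set) → Set
Convex I = ∀ {a b c} → I a → I c → toℕ a < toℕ b → toℕ b < toℕ c → I b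

Saturated : ∀ {n} → Word n → (Fin (n + n) → Set) → Set
Saturated W I = ∀ {r r′} → W r ≡ W r′ → I r → I r′

-- A letter interlaced with x has an occurrence between the two occurrences of x, so the set of
-- letters occurring in I is closed under interlacement.
connected⇒saturated-convex-full : ∀ {n} {W : Word n} {I : Fin (n + n) → Set} →
  ConnectedInterlacement W → Convex I → Saturated W I → ∀ {r} → I r → ∀ r′ → I r′
connected⇒saturated-convex-full {n} {W} {I} connected convex saturated {r} Ir r′ =
  let (r″ , Wr″≡Wr′ , Ir″) = travel (connected (W r) (W r′)) (r , refl , Ir)
  in saturated Wr″≡Wr′ Ir″
  where
  Hit : Fin n → Set
  Hit x = ∃ λ r → W r ≡ x × I r

  step : ∀ {x y} → Interlaced W x y → Hit x → Hit y
  step {y = y} (_ , p₁ , p₂ , q₁ , q₂ , Wp₁ , Wp₂ , Wq₁ , Wq₂ , order) (r , Wr , Ir) = between order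
    where
    Ip₁ : I p₁
    Ip₁ = saturated (trans Wr (sym Wp₁)) Ir
    Ip₂ : I p₂
    Ip₂ = saturated (trans Wr (sym Wp₂)) Ir
    between : (toℕ p₁ < toℕ q₁ × toℕ q₁ < toℕ p₂ × toℕ p₂ < toℕ q₂) ⊎
              (toℕ q₁ < toℕ p₁ × toℕ p₁ < toℕ q₂ × toℕ q₂ < toℕ p₂) → Hit y
    between (inj₁ (p₁<q₁ , q₁<p₂ , _)) = q₁ , Wq₁ , convex Ip₁ Ip₂ p₁<q₁ q₁<p₂
    between (inj₂ (_ , p₁<q₂ , q₂<p₂)) = q₂ , Wq₂ , convex Ip₁ Ip₂ p₁<q₂ q₂<p₂

  travel : ∀ {x y} → Star (Interlaced W) x y → Hit x → Hit y
  travel = Star.fold (λ x y → Hit x → Hit y) (λ i f → f ∘′ step i) id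

unique-pair : ∀ {A : Set} (xs : List A) → length xs ≡ 2 → Unique xs →
  Σ A λ a → Σ A λ b → a ≢ b × a ∈ xs × b ∈ xs × ∀ {c} → c ∈ xs → c ≡ a ⊎ c ≡ b
unique-pair (a ∷ b ∷ []) _ ((a≢b All.∷ _) AllPairs.∷ _) =
  a , b , a≢b , here refl , there (here refl) , λ
    { (here c≡a)         → inj₁ c≡a
    ; (there (here c≡b)) → inj₂ c≡b
    ; (there (there ())) }

pair-cover : ∀ {A : Set} {a b c d r : A} → c ≢ d →
  c ≡ a ⊎ c ≡ b → d ≡ a ⊎ d ≡ b → r ≡ a ⊎ r ≡ b → r ≡ c ⊎ r ≡ d
pair-cover c≢d (inj₁ refl) (inj₁ refl) _          = ⊥-elim (c≢d refl)
pair-cover c≢d (inj₂ refl) (inj₂ refl) _          = ⊥-elim (c≢d refl)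
pair-cover c≢d (inj₁ refl) (inj₂ refl) (inj₁ refl) = inj₁ refl
pair-cover c≢d (inj₁ refl) (inj₂ refl) (inj₂ refl) = inj₂ refl
pair-cover c≢d (inj₂ refl) (inj₁ refl) (inj₁ refl) = inj₂ refl
pair-cover c≢d (inj₂ refl) (inj₁ refl) (inj₂ refl) = inj₁ refl

letters-≢⇒positions-≢ : ∀ {n} {W : Word n} {r r′ x y} → W r ≡ x → W r′ ≡ y → x ≢ y → r ≢ r′
letters-≢⇒positions-≢ Wr≡x Wr′≡y x≢y refl = x≢y (trans (sym Wr≡x) Wr′≡y)

Consecutive-sym : ∀ {n} {W : Word n} {v w} → Consecutive W v w → Consecutive W w v
Consecutive-sym (i , j , i→j , inj₁ letters) = i , j , i→j , inj₂ letters
Consecutive-sym (i , j , i→j , inj₂ letters) = i , j , i→j , inj₁ letters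

ColumnsAgree : ∀ {n} {W : Word n} → Orientation W → Fin n → Fin n → Set
ColumnsAgree O v w = ∀ x → x ≢ v → x ≢ w → naji O x v ≡ naji O x w

ColumnsAgree-sym : ∀ {n} {W : Word n} {O : Orientation W} {v w} → ColumnsAgree O v w → ColumnsAgree O w v
ColumnsAgree-sym agree x x≢w x≢v = sym (agree x x≢v x≢w)

consecutive-outs⇒ColumnsAgree : ∀ {n} {W : Word n} (O : Orientation W) {a b} →
  CycNext {n} (Orientation.out O a) (Orientation.out O b) → ColumnsAgree O a b
consecutive-outs⇒ColumnsAgree {n} {W} O {a} {b} a→b x x≢a x≢b =
  cong (λ β → if β then 0 else 1)
    (offset-<ᵇ-consecutive {n} (ini x) a→b
      (letters-≢⇒positions-≢ {W = W} (ini-ok x) (out-ok b) x≢b)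
      (letters-≢⇒positions-≢ {W = W} (out-ok x) (out-ok a) x≢a)
      (letters-≢⇒positions-≢ {W = W} (out-ok x) (out-ok b) x≢b))
  where open Orientation O

module _ {n : ℕ} {W : Word n} (dow : IsDOW W) where
  private
    N : ℕ
    N = n + n

  occurrences : ∀ x → Σ (Fin N) λ a → Σ (Fin N) λ b →
    a ≢ b × W a ≡ x × W b ≡ x × ∀ {r} → W r ≡ x → r ≡ a ⊎ r ≡ b
  occurrences x =
    let (a , b , a≢b , a∈ , b∈ , cover) = unique-pair (filter occ? (allFin N)) (dow x)
                                            (Unique.filter⁺ occ? (allFin⁺ N))
    in a , b , a≢b , occurs a∈ , occurs b∈ , λ Wr≡x → cover (∈-filter⁺ occ? (∈-allFin _) Wr≡x)
    where
    occ? : ∀ r → Dec (W r ≡ x)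
    occ? r = W r ≟ x
    occurs : ∀ {r} → r ∈ filter occ? (allFin N) → W r ≡ x
    occurs r∈ = proj₂ (∈-filter⁻ occ? {xs = allFin N} r∈)

  other-occurrence : ∀ u → Σ (Fin N) λ u′ → W u′ ≡ W u × u′ ≢ u
  other-occurrence u with occurrences (W u)
  ... | a , b , a≢b , Wa , Wb , cover with cover {u} refl
  ...   | inj₁ refl = b , Wb , ≢-sym a≢b
  ...   | inj₂ refl = a , Wa , a≢b

  ini-or-out : (O : Orientation W) → ∀ {r x} → W r ≡ x →
    r ≡ Orientation.ini O x ⊎ r ≡ Orientation.out O x
  ini-or-out O {r} {x} Wr≡x =
    let (_ , _ , _ , _ , _ , cover) = occurrences x
    in pair-cover (ini≢out x) (cover (ini-ok x)) (cover (out-ok x)) (cover Wr≡x)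
    where open Orientation O

  orientation-saturated : (O : Orientation W) (I : Fin N → Set) →
    (∀ x → I (Orientation.ini O x) → I (Orientation.out O x)) →
    (∀ x → I (Orientation.out O x) → I (Orientation.ini O x)) → Saturated W I
  orientation-saturated O I ini→out out→ini {r} {r′} Wr≡Wr′ Ir
    with ini-or-out O {r} refl | ini-or-out O {r′} (sym Wr≡Wr′)
  ... | inj₁ r≡ini | inj₁ r′≡ini = subst I (trans r≡ini (sym r′≡ini)) Ir
  ... | inj₁ r≡ini | inj₂ r′≡out = subst I (sym r′≡out) (ini→out (W r) (subst I r≡ini Ir))
  ... | inj₂ r≡out | inj₁ r′≡ini = subst I (sym r′≡ini) (out→ini (W r) (subst I r≡out Ir))
  ... | inj₂ r≡out | inj₂ r′≡out = subst I (trans r≡out (sym r′≡out)) Ir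

  orientation-with-out : (o : Fin n → Fin N) → (∀ x → W (o x) ≡ x) → Orientation W
  orientation-with-out o W-o = record
    { ini     = λ x → proj₁ (other-occurrence (o x))
    ; out     = o
    ; ini-ok  = λ x → trans (proj₁ (proj₂ (other-occurrence (o x)))) (W-o x)
    ; out-ok  = W-o
    ; ini≢out = λ x → proj₂ (proj₂ (other-occurrence (o x)))
    }

  orientation-with-outs : ∀ {a b i j} → a ≢ b → W i ≡ a → W j ≡ b →
    Σ (Orientation W) λ O → Orientation.out O a ≡ i × Orientation.out O b ≡ j
  orientation-with-outs {a} {b} {i} {j} a≢b Wi Wj =
    orientation-with-out (λ x → proj₁ (chosen x)) (λ x → proj₂ (chosen x)) , chosen-a , chosen-b
    where
    chosen : ∀ x → Σ (Fin N) λ r → W r ≡ x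
    chosen x with x ≟ a | x ≟ b
    ... | yes refl | _        = i , Wi
    ... | no _     | yes refl = j , Wj
    ... | no _     | no _     = let (r , _ , _ , Wr , _) = occurrences x in r , Wr

    chosen-a : proj₁ (chosen a) ≡ i
    chosen-a with a ≟ a | a ≟ b
    ... | yes refl | _ = refl
    ... | no a≢a   | _ = ⊥-elim (a≢a refl)

    chosen-b : proj₁ (chosen b) ≡ j
    chosen-b with b ≟ a | b ≟ b
    ... | yes refl | _        = ⊥-elim (a≢b refl)
    ... | no _     | yes refl = refl
    ... | no _     | no b≢b   = ⊥-elim (b≢b refl)

  module _ (connected : ConnectedInterlacement W) (O : Orientation W) where
    open Orientation O

    private
      positions-≢ : ∀ {r r′ x y} → W r ≡ x → W r′ ≡ y → x ≢ y → r ≢ r′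
      positions-≢ = letters-≢⇒positions-≢ {W = W}

    module TerminalBlock {v w : Fin n} (v≢w : v ≢ w) (p<q : toℕ (out v) < toℕ (out w))
                         (agree : ColumnsAgree O v w) where
      p q : Fin N
      p = out v
      q = out w

      -- p and q are included exactly when v and w then have both occurrences in Span.
      Span : Fin N → Set
      Span r = Between p q r ⊎ (r ≡ p × Between p q (ini v)) ⊎ (r ≡ q × Between p q (ini w))

      span-bounds : ∀ {r} → Span r → toℕ p ≤ toℕ r × toℕ r ≤ toℕ q
      span-bounds (inj₁ (p<r , r<q))         = <⇒≤ p<r , <⇒≤ r<q
      span-bounds (inj₂ (inj₁ (refl , _)))   = ≤-refl , <⇒≤ p<q
      span-bounds (inj₂ (inj₂ (refl , _)))   = <⇒≤ p<q , ≤-refl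

      outside-span : ∀ {r} → toℕ r < toℕ p ⊎ toℕ q < toℕ r → ¬ Span r
      outside-span (inj₁ r<p) span = <⇒≱ r<p (proj₁ (span-bounds span))
      outside-span (inj₂ q<r) span = <⇒≱ q<r (proj₂ (span-bounds span))

      span-convex : Convex Span
      span-convex Sa Sc a<b b<c =
        inj₁ (≤-<-trans (proj₁ (span-bounds Sa)) a<b , <-≤-trans b<c (proj₂ (span-bounds Sc)))

      span-other : ∀ {r x} → W r ≡ x → x ≢ v → x ≢ w → Span r → Between p q r
      span-other Wr x≢v x≢w (inj₁ inside)            = inside
      span-other Wr x≢v x≢w (inj₂ (inj₁ (refl , _))) = ⊥-elim (x≢v (trans (sym Wr) (out-ok v)))
      span-other Wr x≢v x≢w (inj₂ (inj₂ (refl , _))) = ⊥-elim (x≢w (trans (sym Wr) (out-ok w)))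

      agree-<ᵇ : ∀ x → x ≢ v → x ≢ w →
        (offset {n} (ini x) p <ᵇ offset {n} (ini x) (out x)) ≡
        (offset {n} (ini x) q <ᵇ offset {n} (ini x) (out x))
      agree-<ᵇ x x≢v x≢w = if01-injective (agree x x≢v x≢w)

      ini→out : ∀ x → Span (ini x) → Span (out x)
      ini→out x with x ≟ v | x ≟ w
      ... | yes refl | _ = λ
        { (inj₁ inside)              → inj₂ (inj₁ (refl , inside))
        ; (inj₂ (inj₁ (ini≡p , _)))  → ⊥-elim (ini≢out v ini≡p)
        ; (inj₂ (inj₂ (ini≡q , _)))  → ⊥-elim (positions-≢ (ini-ok v) (out-ok w) v≢w ini≡q) }
      ... | no _ | yes refl = λ
        { (inj₁ inside)              → inj₂ (inj₂ (refl , inside))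
        ; (inj₂ (inj₁ (ini≡p , _)))  → ⊥-elim (positions-≢ (ini-ok w) (out-ok v) (≢-sym v≢w) ini≡p)
        ; (inj₂ (inj₂ (ini≡q , _)))  → ⊥-elim (ini≢out w ini≡q) }
      ... | no x≢v | no x≢w = λ span → inj₁
        (between-same-side {n} (positions-≢ (out-ok x) (out-ok v) x≢v)
                               (positions-≢ (out-ok x) (out-ok w) x≢w)
          (agree-<ᵇ x x≢v x≢w) (span-other (ini-ok x) x≢v x≢w span))

      out→ini : ∀ x → Span (out x) → Span (ini x)
      out→ini x with x ≟ v | x ≟ w
      ... | yes refl | _ = λ
        { (inj₁ (p<p , _))           → ⊥-elim (<-irrefl refl p<p)
        ; (inj₂ (inj₁ (_ , inside))) → inj₁ inside
        ; (inj₂ (inj₂ (p≡q , _)))    → ⊥-elim (<⇒≢ p<q (cong toℕ p≡q)) }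
      ... | no _ | yes refl = λ
        { (inj₁ (_ , q<q))           → ⊥-elim (<-irrefl refl q<q)
        ; (inj₂ (inj₁ (q≡p , _)))    → ⊥-elim (<⇒≢ p<q (cong toℕ (sym q≡p)))
        ; (inj₂ (inj₂ (_ , inside))) → inj₁ inside }
      ... | no x≢v | no x≢w = λ span → inj₁
        (between-same-side⁻¹ {n} (positions-≢ (ini-ok x) (out-ok v) x≢v)
                                 (positions-≢ (ini-ok x) (out-ok w) x≢w)
          (agree-<ᵇ x x≢v x≢w) (span-other (out-ok x) x≢v x≢w span))

      span-full : ∀ {r} → Span r → ∀ r′ → Span r′
      span-full = connected⇒saturated-convex-full connected span-convex
                    (orientation-saturated O Span ini→out out→ini)

    ColumnsAgree⇒consecutive-< : ∀ {v w} → v ≢ w → toℕ (out v) < toℕ (out w) →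
      ColumnsAgree O v w → Consecutive W v w
    ColumnsAgree⇒consecutive-< {v} {w} v≢w p<q agree with adjacent-or-gap {n} p<q
    ... | inj₁ p→q        = out v , out w , p→q , inj₁ (out-ok v , out-ok w)
    ... | inj₂ (inj₁ q→p) = out w , out v , q→p , inj₂ (out-ok w , out-ok v)
    ... | inj₂ (inj₂ ((m , m-inside) , e , e-outside)) =
      ⊥-elim (outside-span e-outside (span-full (inj₁ m-inside) e))
      where open TerminalBlock v≢w p<q agree

    ColumnsAgree⇒consecutive : ∀ {v w} → v ≢ w → ColumnsAgree O v w → Consecutive W v w
    ColumnsAgree⇒consecutive {v} {w} v≢w agree with <-cmp (toℕ (out v)) (toℕ (out w))
    ... | tri< v<w _ _ = ColumnsAgree⇒consecutive-< v≢w v<w agree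
    ... | tri≈ _ v≡w _ = ⊥-elim (positions-≢ (out-ok v) (out-ok w) v≢w (toℕ-injective v≡w))
    ... | tri> _ _ w<v =
      Consecutive-sym (ColumnsAgree⇒consecutive-< (≢-sym v≢w) w<v (ColumnsAgree-sym {O = O} agree))

  consecutive⇒ColumnsAgree : ∀ {v w} → v ≢ w → Consecutive W v w →
    Σ (Orientation W) λ O → ColumnsAgree O v w
  consecutive⇒ColumnsAgree v≢w (i , j , i→j , inj₁ (Wi , Wj)) =
    let (O , out-v , out-w) = orientation-with-outs v≢w Wi Wj
    in O , consecutive-outs⇒ColumnsAgree O (subst₂ (CycNext {n}) (sym out-v) (sym out-w) i→j)
  consecutive⇒ColumnsAgree v≢w (i , j , i→j , inj₂ (Wi , Wj)) =
    let (O , out-w , out-v) = orientation-with-outs (≢-sym v≢w) Wi Wj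
    in O , ColumnsAgree-sym {O = O}
             (consecutive-outs⇒ColumnsAgree O (subst₂ (CycNext {n}) (sym out-w) (sym out-v) i→j))

proposition11 : (n : ℕ) (W : Word n) → IsDOW W → ConnectedInterlacement W →
    (v w : Fin n) → v ≢ w →
    Consecutive W v w ⇔
      Σ (Orientation W) (λ O → ∀ x → x ≢ v → x ≢ w → naji O x v ≡ naji O x w)
proposition11 n W dow connected v w v≢w =
  mk⇔ (consecutive⇒ColumnsAgree dow v≢w)
      (λ (O , agree) → ColumnsAgree⇒consecutive dow connected O v≢w agree)
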